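{- Let $\mathbf P=(P,\le,{}^*,0,1)$ be a pseudocomplemented poset such that $(P^*,\le)$ is a complete lattice having the property that for each subset $B$ of $P^*$ the infimum of $B$ in $(P,\le)$ exists and coincides with the infimum of $B$ in $(P^*,\le)$. Then $\mathrm{Cl}(\mathbf P)=\{x^\perp\mid x\in P\}$.
   Context: A bounded poset $(P,\le,0,1)$ is pseudocomplemented if for each $x\in P$ there exists a greatest element $y\in P$ such that the infimum $x\wedge y$ exists and equals $0$; it is denoted $x^*$. $P^*:=\{x^*\mid x\in P\}$. The orthogonality relation is $x\perp y$ iff $y\le x^*$. For $A\subseteq P$, $A^\perp:=\{x\in P\mid x\perp y\text{ for all }y\in A\}$, $x^\perp:=\{x\}^\perp$. $A$ is closed if $A^{\perp\perp}=A$; $\mathrm{Cl}(\mathbf P)$ is the set of all closed subsets of $P$. -}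

module Defs where

open import Level using (Level; _⊔_; Lift)
open import Data.Product using (Σ; ∃; _×_; _,_)
open import Relation.Unary using (Pred; _⊆_; _≐_)
open import Relation.Binary.Bundles using (Poset)
open import Function.Bundles using (_⇔_)

module PosetDefs {c ℓ₁ ℓ₂ : Level} (P : Poset c ℓ₁ ℓ₂) where
  open Poset P renaming (Carrier to A)

  -- subsets of P: predicates at a fixed level (closed under ⊥ and P*)
  Subset : Set _
  Subset = Pred A (c ⊔ ℓ₁ ⊔ ℓ₂)

  IsMeet : A → A → A → Set _
  IsMeet x y m = (m ≤ x) × (m ≤ y) × (∀ z → z ≤ x → z ≤ y → z ≤ m)

  IsBounded : A → A → Set _
  IsBounded 0# 1# = (∀ x → 0# ≤ x) × (∀ x → x ≤ 1#)

  IsPseudocomplement : A → (A → A) → Set _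
  IsPseudocomplement 0# _* =
    ∀ x → IsMeet x (x *) 0# × (∀ y → IsMeet x y 0# → y ≤ x *)

  module _ (_* : A → A) where
    InStar : Pred A (c ⊔ ℓ₁)
    InStar z = ∃ λ x → z ≈ x *

    LowerBound : Subset → A → Set _
    LowerBound B m = ∀ b → B b → m ≤ b

    UpperBound : Subset → A → Set _
    UpperBound B m = ∀ b → B b → b ≤ m

    IsInf : Subset → A → Set _
    IsInf B m = LowerBound B m × (∀ z → LowerBound B z → z ≤ m)

    IsInfStar : Subset → A → Set _
    IsInfStar B m = InStar m × LowerBound B m
                    × (∀ z → InStar z → LowerBound B z → z ≤ m)

    IsSupStar : Subset → A → Set _
    IsSupStar B m = InStar m × UpperBound B m
                    × (∀ z → InStar z → UpperBound B z → m ≤ z)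

    StarCompleteLattice : Set _
    StarCompleteLattice = ∀ (B : Subset) → B ⊆ InStar →
      (∃ λ m → IsInfStar B m) × (∃ λ m → IsSupStar B m)

    StarInfsAreInfs : Set _
    StarInfsAreInfs = ∀ (B : Subset) → B ⊆ InStar →
      ∃ λ m → IsInf B m × IsInfStar B m

    _⊥_ : A → A → Set ℓ₂
    x ⊥ y = y ≤ x *

    _^⊥ : Subset → Subset
    (S ^⊥) x = ∀ y → S y → x ⊥ y

    ⟨_⟩^⊥ : A → Subset
    ⟨ x ⟩^⊥ z = Lift (c ⊔ ℓ₁ ⊔ ℓ₂) (z ⊥ x)

    Closed : Subset → Set _
    Closed S = ((S ^⊥) ^⊥) ≐ S

    ClEqualsPerps : Set _
    ClEqualsPerps = ∀ (S : Subset) → Closed S ⇔ (∃ λ x → S ≐ ⟨ x ⟩^⊥)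

-- Orthogonality is symmetric, since 0 is the least element and x* is the largest
-- element meeting x in 0. Hence z ∈ A^⊥ iff z ≤ a* for every a ∈ A, i.e. iff z lies
-- below the infimum of {a* | a ∈ A}. That infimum exists in P and lies in P*, so it is
-- some w*, and then A^⊥ = {z | z ≤ w*} = w^⊥. A closed set is the orthogonal of its
-- orthogonal, so it is of this form. Conversely x ∈ (x^⊥)^⊥, so every element of
-- (x^⊥)^⊥⊥ is orthogonal to x, and x^⊥ is closed.
module Submission where

open import Defs
open import Level using (Level; lift; lower)
open import Relation.Binary.Bundles using (Poset)
open import Data.Product using (∃; _×_; _,_; proj₁; proj₂)
open import Function.Bundles using (mk⇔)
open import Relation.Unary using (_⊆_; _≐_)
open import Relation.Unary.Properties using (≐-trans)

module Orthogonality {c ℓ₁ ℓ₂ : Level} (P : Poset c ℓ₁ ℓ₂) where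
  open Poset P renaming (Carrier to A)
  open PosetDefs P

  module _ {0# : A} {_* : A → A} (0#-least : ∀ x → 0# ≤ x)
           (pseudo : IsPseudocomplement 0# _*) where

    ≤*-swap : ∀ {x y} → y ≤ x * → x ≤ y *
    ≤*-swap {x} {y} y≤x* = proj₂ (pseudo y) x
      (0#-least y , 0#-least x , λ z z≤y z≤x → proj₂ (proj₂ (proj₁ (pseudo x))) z z≤x (trans z≤y y≤x*))

    ⊆-perp-perp : (S : Subset) → S ⊆ _^⊥ _* (_^⊥ _* S)
    ⊆-perp-perp S z∈S y y∈S^⊥ = ≤*-swap (y∈S^⊥ _ z∈S)

    principal-closed : (S : Subset) → (∃ λ x → S ≐ ⟨_⟩^⊥ _* x) → Closed _* S
    principal-closed S (x , S⊆x^⊥ , x^⊥⊆S) =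
      (λ z∈S^⊥⊥ → x^⊥⊆S (lift (z∈S^⊥⊥ x λ y y∈S → ≤*-swap (lower (S⊆x^⊥ y∈S))))) ,
      ⊆-perp-perp S

    module _ (starInfs : StarInfsAreInfs _*) where

      perp-principal : (S : Subset) → ∃ λ w → _^⊥ _* S ≐ ⟨_⟩^⊥ _* w
      perp-principal S = w , to , from
        where
        stars : Subset
        stars b = ∃ λ a → S a × (b ≈ a *)

        inf : ∃ λ m → IsInf _* stars m × IsInfStar _* stars m
        inf = starInfs stars (λ (a , _ , b≈a*) → a , b≈a*)

        m : A
        m = proj₁ inf

        m-isInf : IsInf _* stars m
        m-isInf = proj₁ (proj₂ inf)

        w : A
        w = proj₁ (proj₁ (proj₂ (proj₂ inf)))

        m≈w* : m ≈ w *
        m≈w* = proj₂ (proj₁ (proj₂ (proj₂ inf)))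

        to : _^⊥ _* S ⊆ ⟨_⟩^⊥ _* w
        to {z} z∈S^⊥ = lift (≤*-swap (≤-respʳ-≈ m≈w* z≤m))
          where
          z≤m : z ≤ m
          z≤m = proj₂ m-isInf z λ b (a , a∈S , b≈a*) → ≤-respʳ-≈ (Eq.sym b≈a*) (≤*-swap (z∈S^⊥ a a∈S))

        from : ⟨_⟩^⊥ _* w ⊆ _^⊥ _* S
        from (lift w≤z*) a a∈S =
          ≤*-swap (trans (≤-respʳ-≈ (Eq.sym m≈w*) (≤*-swap w≤z*)) (proj₁ m-isInf (a *) (a , a∈S , Eq.refl)))

      closed-principal : (S : Subset) → Closed _* S → ∃ λ w → S ≐ ⟨_⟩^⊥ _* w
      closed-principal S (S^⊥⊥⊆S , S⊆S^⊥⊥) =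
        let w , S^⊥⊥≐w^⊥ = perp-principal (_^⊥ _* S)
        in w , ≐-trans (S⊆S^⊥⊥ , S^⊥⊥⊆S) S^⊥⊥≐w^⊥

corollary4 : {c ℓ₁ ℓ₂ : Level} (P : Poset c ℓ₁ ℓ₂) (0# 1# : Poset.Carrier P)
    (_* : Poset.Carrier P → Poset.Carrier P) →
    PosetDefs.IsBounded P 0# 1# → PosetDefs.IsPseudocomplement P 0# _* →
    PosetDefs.StarCompleteLattice P _* → PosetDefs.StarInfsAreInfs P _* →
    PosetDefs.ClEqualsPerps P _*
corollary4 P _ _ _ (0#-least , _) pseudo _ starInfs S =
  mk⇔ (closed-principal 0#-least pseudo starInfs S) (principal-closed 0#-least pseudo S)
  where open Orthogonality P
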